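{- Let $\mathbb X_i=\langle X_i,\rho_i\rangle$, $i\in I$, be tournaments (in particular, strict linear orders) with non-empty pairwise disjoint domains. Then $\bigcup_{i\in I}\mathbb X_i$ is not reversible iff there is a surjection $f:I\to I$ which is not injective such that for every $j\in I$ there is a partition $\{A_i:i\in f^{ -1}[\{j\}]\}$ of $X_j$ with $\langle A_i,\rho_j\cap A_i^2\rangle\cong\mathbb X_i$ for all $i\in f^{ -1}[\{j\}]$.
   Context: A tournament is a pair $\langle X,\rho\rangle$ with $\rho\subseteq X^2$ irreflexive such that for distinct $x,y\in X$ exactly one of $\langle x,y\rangle\in\rho$, $\langle y,x\rangle\in\rho$ holds. A homomorphism preserves the relation, a condensation is a bijective homomorphism, and a structure is reversible iff every condensation from it to itself is an automorphism. The union of disjoint structures is $\langle\bigcup X_i,\bigcup\rho_i\rangle$. -}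

module Defs where

open import Level using (0ℓ)
open import Data.Bool using (Bool; true)
open import Data.Product using (Σ; Σ-syntax; _×_; proj₁; _,_)
open import Data.Sum using (_⊎_)
open import Relation.Nullary using (¬_)
open import Relation.Binary using (Rel)
open import Relation.Binary.PropositionalEquality using (_≡_; _≢_; subst; sym)
open import Function.Definitions using (Bijective; Injective; Surjective)
open import Function.Bundles using (_⇔_)

record Structure : Set₁ where
  constructor ⟨_,_⟩
  field
    Carrier : Set
    rel     : Rel Carrier 0ℓ
open Structure public

record IsTournament (S : Structure) : Set where
  field
    irrefl    : ∀ x → ¬ rel S x x
    connex    : ∀ x y → x ≢ y → rel S x y ⊎ rel S y x
    exclusive : ∀ x y → x ≢ y → ¬ (rel S x y × rel S y x)

IsHom : (S T : Structure) → (Carrier S → Carrier T) → Set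
IsHom S T f = ∀ x y → rel S x y → rel T (f x) (f y)

IsCondensation : (S T : Structure) → (Carrier S → Carrier T) → Set
IsCondensation S T f = Bijective _≡_ _≡_ f × IsHom S T f

IsIso : (S T : Structure) → (Carrier S → Carrier T) → Set
IsIso S T f = Bijective _≡_ _≡_ f × (∀ x y → rel S x y ⇔ rel T (f x) (f y))

IsAutomorphism : (S : Structure) → (Carrier S → Carrier S) → Set
IsAutomorphism S f = IsIso S S f

_≅_ : Structure → Structure → Set
S ≅ T = Σ (Carrier S → Carrier T) (IsIso S T)

Reversible : Structure → Set
Reversible S = ∀ f → IsCondensation S S f → IsAutomorphism S f

-- Union of a family of (disjoint) structures, realized as the disjoint sum.
data UnionRel {I : Set} (𝕏 : I → Structure) : Rel (Σ I (λ i → Carrier (𝕏 i))) 0ℓ where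
  inRel : ∀ {i x y} → rel (𝕏 i) x y → UnionRel 𝕏 (i , x) (i , y)

⋃ : {I : Set} → (I → Structure) → Structure
⋃ {I} 𝕏 = ⟨ Σ I (λ i → Carrier (𝕏 i)) , UnionRel 𝕏 ⟩

Sub : (S : Structure) → (Carrier S → Bool) → Structure
Sub S A = ⟨ Σ (Carrier S) (λ x → A x ≡ true) , (λ a b → rel S (proj₁ a) (proj₁ b)) ⟩

-- Given f : I → I, the family {A i : i ∈ I}, A i ⊆ X (f i), is such that
-- for every j, {A i : i ∈ f⁻¹[{j}]} is a partition of X j (covering + disjoint;
-- nonemptiness of blocks is not included here, it follows from A i ≅ X i).
IsFiberPartition : {I : Set} (𝕏 : I → Structure) (f : I → I)
                   (A : (i : I) → Carrier (𝕏 (f i)) → Bool) → Set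
IsFiberPartition {I} 𝕏 f A =
  (∀ j (y : Carrier (𝕏 j)) →
     Σ[ i ∈ I ] Σ[ p ∈ f i ≡ j ] A i (subst (λ k → Carrier (𝕏 k)) (sym p) y) ≡ true)
  × (∀ j (y : Carrier (𝕏 j)) i i' (p : f i ≡ j) (p' : f i' ≡ j) →
     A i  (subst (λ k → Carrier (𝕏 k)) (sym p)  y) ≡ true →
     A i' (subst (λ k → Carrier (𝕏 k)) (sym p') y) ≡ true →
     i ≡ i')

-- Classical logic (the paper works in ZFC).
Classical : Set₁
Classical = (P : Set) → Relation.Nullary.Dec P
  where import Relation.Nullary

module Submission where

open import Defs
open import Data.Bool using (Bool; true)
open import Data.Bool.Properties using (T-≡)
open import Data.Product using (Σ; Σ-syntax; _×_; _,_; proj₁; proj₂)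
open import Data.Product.Properties using (,-injectiveˡ; ,-injectiveʳ-UIP; Σ-≡,≡→≡)
open import Data.Sum using (_⊎_; inj₁; inj₂)
open import Data.Empty using (⊥-elim)
open import Relation.Nullary using (¬_; yes; no; isYes)
open import Relation.Nullary.Decidable using (toWitness; fromWitness; decidable-stable)
open import Relation.Binary.PropositionalEquality
  using (_≡_; _≢_; refl; sym; trans; cong; subst; subst₂)
open import Relation.Binary.PropositionalEquality.Properties using (subst-subst-sym)
open import Axiom.UniquenessOfIdentityProofs.WithK using (uip)
open import Function.Definitions using (Injective; Surjective)
open import Function.Bundles using (_⇔_; mk⇔; Equivalence)

-- Every
-- homomorphism F out of 𝕏 maps each component 𝕏ᵢ into a single
-- component, since any two distinct points of a tournament are related
-- and the union relates only points of the same component.  So a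
-- condensation F of 𝕏 induces a component map g : I → I, which is
-- surjective because F is.  Inside a component F also reflects the
-- relation (target relation asymmetric), hence F is an automorphism iff
-- g is injective.  Moreover the images F[Xᵢ], i ∈ g⁻¹[{j}], partition X_j
-- into blocks isomorphic to the 𝕏ᵢ.  Conversely, such a fibre partition
-- reassembles into a condensation whose component map is g.  Classical
-- logic is used to compare points and to decide membership in an image.

module Points {I : Set} (C : I → Set) where

  transport-pair : ∀ {k j} (p : k ≡ j) (y : C j) →
                   _≡_ {A = Σ I C} (k , subst C (sym p) y) (j , y)
  transport-pair p y = Σ-≡,≡→≡ (p , subst-subst-sym p)

  relocate : (c : Σ I C) {k : I} (q : proj₁ c ≡ k) → c ≡ (k , subst C q (proj₂ c))
  relocate c q = Σ-≡,≡→≡ (q , refl)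

  transport-snd : ∀ {a b} {y : C a} {y' : C b} (e : _≡_ {A = Σ I C} (a , y) (b , y')) →
                  subst C (sym (,-injectiveˡ e)) y' ≡ y
  transport-snd refl = refl

  snd-injective : ∀ {a} {y y' : C a} → _≡_ {A = Σ I C} (a , y) (a , y') → y ≡ y'
  snd-injective = ,-injectiveʳ-UIP uip

Sub-≡ : ∀ {S A} {s s' : Carrier (Sub S A)} → proj₁ s ≡ proj₁ s' → s ≡ s'
Sub-≡ e = Σ-≡,≡→≡ (e , uip _ _)

module Iso {S T : Structure} (iso : S ≅ T) where

  to : Carrier S → Carrier T
  to = proj₁ iso

  to-injective : Injective _≡_ _≡_ to
  to-injective = proj₁ (proj₁ (proj₂ iso))

  from : Carrier T → Carrier S
  from y = proj₁ (proj₂ (proj₁ (proj₂ iso)) y)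

  to-from : ∀ y → to (from y) ≡ y
  to-from y = proj₂ (proj₂ (proj₁ (proj₂ iso)) y) refl

  from-to : ∀ x → from (to x) ≡ x
  from-to x = to-injective (to-from (to x))

  from-injective : Injective _≡_ _≡_ from
  from-injective {y} {y'} e = trans (sym (to-from y)) (trans (cong to e) (to-from y'))

  from-preserves : ∀ {y y'} → rel T y y' → rel S (from y) (from y')
  from-preserves {y} {y'} r =
    Equivalence.from (proj₂ (proj₂ iso) (from y) (from y'))
      (subst₂ (rel T) (sym (to-from y)) (sym (to-from y')) r)

module TournamentFacts {S : Structure} (T : IsTournament S) where
  open IsTournament T

  related⇒distinct : ∀ {x y} → rel S x y → x ≢ y
  related⇒distinct r refl = irrefl _ r

  asymmetric : ∀ {x y} → rel S x y → ¬ rel S y x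
  asymmetric r r' = exclusive _ _ (related⇒distinct r) (r , r')

module UnionFacts {I : Set} (𝕏 : I → Structure) where

  component-≡ : ∀ {a b} → UnionRel 𝕏 a b → proj₁ a ≡ proj₁ b
  component-≡ (inRel _) = refl

  inComponent : ∀ {i x y} → UnionRel 𝕏 (i , x) (i , y) → rel (𝕏 i) x y
  inComponent (inRel r) = r

  module _ (T : ∀ i → IsTournament (𝕏 i)) where

    union-distinct : ∀ {a b} → UnionRel 𝕏 a b → a ≢ b
    union-distinct (inRel r) refl = TournamentFacts.related⇒distinct (T _) r refl

    union-asymmetric : ∀ {a b} → UnionRel 𝕏 a b → ¬ UnionRel 𝕏 b a
    union-asymmetric (inRel r) r' = TournamentFacts.asymmetric (T _) r (inComponent r')

    union-connex : ∀ a b → proj₁ a ≡ proj₁ b → a ≢ b → UnionRel 𝕏 a b ⊎ UnionRel 𝕏 b a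
    union-connex (i , x) (.i , y) refl a≢b
      with IsTournament.connex (T i) x y (λ x≡y → a≢b (cong (i ,_) x≡y))
    ... | inj₁ r = inj₁ (inRel r)
    ... | inj₂ r = inj₂ (inRel r)

open UnionFacts

module UnionHomomorphism {I J : Set} {𝕏 : I → Structure} {𝕐 : J → Structure}
    (T𝕏 : ∀ i → IsTournament (𝕏 i))
    (F : Carrier (⋃ 𝕏) → Carrier (⋃ 𝕐)) (hom : IsHom (⋃ 𝕏) (⋃ 𝕐) F) where

  sameComponent : Classical → ∀ i x y → proj₁ (F (i , x)) ≡ proj₁ (F (i , y))
  sameComponent cl i x y with cl (x ≡ y)
  ... | yes refl = refl
  ... | no x≢y with IsTournament.connex (T𝕏 i) x y x≢y
  ... | inj₁ r = component-≡ 𝕐 (hom _ _ (inRel r))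
  ... | inj₂ r = sym (component-≡ 𝕐 (hom _ _ (inRel r)))

  reflectsInComponent : (∀ j → IsTournament (𝕐 j)) →
    ∀ i x y → UnionRel 𝕐 (F (i , x)) (F (i , y)) → rel (𝕏 i) x y
  reflectsInComponent T𝕐 i x y r
    with IsTournament.connex (T𝕏 i) x y (λ { refl → union-distinct 𝕐 T𝕐 r refl })
  ... | inj₁ rxy = rxy
  ... | inj₂ ryx = ⊥-elim (union-asymmetric 𝕐 T𝕐 r (hom _ _ (inRel ryx)))

nonReversible⇒witness : Classical → (S : Structure) → ¬ Reversible S →
  Σ[ F ∈ (Carrier S → Carrier S) ] IsCondensation S S F × ¬ IsAutomorphism S F
nonReversible⇒witness cl S nonrev =
  decidable-stable (cl _) λ none →
    nonrev λ F cond → decidable-stable (cl _) λ notAuto → none (F , cond , notAuto)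

componentMap : {I : Set} {𝕏 : I → Structure} → (∀ i → Carrier (𝕏 i)) →
               (Carrier (⋃ 𝕏) → Carrier (⋃ 𝕏)) → I → I
componentMap x₀ F i = proj₁ (F (i , x₀ i))

module SelfCondensation (cl : Classical) {I : Set} {𝕏 : I → Structure}
    (T : ∀ i → IsTournament (𝕏 i)) (x₀ : ∀ i → Carrier (𝕏 i))
    (F : Carrier (⋃ 𝕏) → Carrier (⋃ 𝕏)) (cond : IsCondensation (⋃ 𝕏) (⋃ 𝕏) F) where

  open Points (λ i → Carrier (𝕏 i))
  open UnionHomomorphism T F (proj₂ cond)

  F-injective : Injective _≡_ _≡_ F
  F-injective = proj₁ (proj₁ cond)

  F-surjective : Surjective _≡_ _≡_ F
  F-surjective = proj₂ (proj₁ cond)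

  g : I → I
  g = componentMap {𝕏 = 𝕏} x₀ F

  g-spec : ∀ i x → proj₁ (F (i , x)) ≡ g i
  g-spec i x = sameComponent cl i x (x₀ i)

  preimage-index : ∀ j y → g (proj₁ (proj₁ (F-surjective (j , y)))) ≡ j
  preimage-index j y =
    let (i , x) = proj₁ (F-surjective (j , y))
    in trans (sym (g-spec i x)) (cong proj₁ (proj₂ (F-surjective (j , y)) refl))

  g-surjective : Surjective _≡_ _≡_ g
  g-surjective j = proj₁ (proj₁ (F-surjective (j , x₀ j))) , λ { refl → preimage-index j (x₀ j) }

  injective⇒automorphism : Injective _≡_ _≡_ g → IsAutomorphism (⋃ 𝕏) F
  injective⇒automorphism g-inj = proj₁ cond , λ a b → mk⇔ (proj₂ cond a b) (reflects a b)
    where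
    reflects : ∀ a b → UnionRel 𝕏 (F a) (F b) → UnionRel 𝕏 a b
    reflects (i , x) (i' , y) r
      with g-inj (trans (sym (g-spec i x)) (trans (component-≡ 𝕏 r) (g-spec i' y)))
    ... | refl = inRel (reflectsInComponent T i x y r)

  -- Two distinct components with the same image component would give two
  -- related image points whose preimages lie in different components.
  automorphism⇒injective : IsAutomorphism (⋃ 𝕏) F → Injective _≡_ _≡_ g
  automorphism⇒injective auto {a} {b} ga≡gb with cl (a ≡ b)
  ... | yes a≡b = a≡b
  ... | no a≢b with union-connex 𝕏 T (F (a , x₀ a)) (F (b , x₀ b)) ga≡gb
                      (λ e → a≢b (,-injectiveˡ (F-injective e)))
  ... | inj₁ r = component-≡ 𝕏 (Equivalence.from (proj₂ auto _ _) r)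
  ... | inj₂ r = sym (component-≡ 𝕏 (Equivalence.from (proj₂ auto _ _) r))

  InImage : (i : I) → Carrier (𝕏 (g i)) → Set
  InImage i y = Σ[ x ∈ Carrier (𝕏 i) ] F (i , x) ≡ (g i , y)

  image : (i : I) → Carrier (𝕏 (g i)) → Bool
  image i y = isYes (cl (InImage i y))

  image-sound : ∀ {i y} → image i y ≡ true → InImage i y
  image-sound e = toWitness (Equivalence.from T-≡ e)

  image-complete : ∀ {i y} → InImage i y → image i y ≡ true
  image-complete p = Equivalence.to T-≡ (fromWitness p)

  image-partition : IsFiberPartition 𝕏 g image
  image-partition = covers , disjoint
    where
    covers : ∀ j y → Σ[ i ∈ I ] Σ[ p ∈ g i ≡ j ]
                       image i (subst (λ k → Carrier (𝕏 k)) (sym p) y) ≡ true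
    covers j y =
      let (i , x) = proj₁ (F-surjective (j , y))
          p = preimage-index j y
      in i , p , image-complete (x , trans (proj₂ (F-surjective (j , y)) refl)
                                           (sym (transport-pair p y)))
    disjoint : ∀ j y i i' (p : g i ≡ j) (p' : g i' ≡ j) →
      image i (subst (λ k → Carrier (𝕏 k)) (sym p) y) ≡ true →
      image i' (subst (λ k → Carrier (𝕏 k)) (sym p') y) ≡ true → i ≡ i'
    disjoint j y i i' p p' a a' =
      let (x , e) = image-sound a
          (x' , e') = image-sound a'
      in ,-injectiveˡ (F-injective (trans (trans e (transport-pair p y))
                                          (sym (trans e' (transport-pair p' y)))))

  image≅component : ∀ i → Sub (𝕏 (g i)) (image i) ≅ 𝕏 i
  image≅component i = preimage , (preimage-injective , preimage-surjective) ,
                      λ s s' → mk⇔ (preserves s s') (reflects s s')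
    where
    Block = Carrier (Sub (𝕏 (g i)) (image i))

    preimage : Block → Carrier (𝕏 i)
    preimage (_ , a) = proj₁ (image-sound a)

    preimage-spec : ∀ s → F (i , preimage s) ≡ (g i , proj₁ s)
    preimage-spec (_ , a) = proj₂ (image-sound a)

    preimage-injective : Injective _≡_ _≡_ preimage
    preimage-injective {s} {s'} e = Sub-≡ {𝕏 (g i)} {image i} (snd-injective
      (trans (sym (preimage-spec s)) (trans (cong (λ x → F (i , x)) e) (preimage-spec s'))))

    preimage-surjective : Surjective _≡_ _≡_ preimage
    preimage-surjective x = s , λ { refl → same }
      where
      moved = relocate (F (i , x)) (g-spec i x)
      s : Block
      s = _ , image-complete (x , moved)
      same : preimage s ≡ x
      same = snd-injective (F-injective (trans (preimage-spec s) (sym moved)))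

    preserves : ∀ s s' → rel (𝕏 (g i)) (proj₁ s) (proj₁ s') →
                rel (𝕏 i) (preimage s) (preimage s')
    preserves s s' r = reflectsInComponent T i _ _
      (subst₂ (UnionRel 𝕏) (sym (preimage-spec s)) (sym (preimage-spec s')) (inRel r))

    reflects : ∀ s s' → rel (𝕏 i) (preimage s) (preimage s') →
               rel (𝕏 (g i)) (proj₁ s) (proj₁ s')
    reflects s s' r = inComponent 𝕏
      (subst₂ (UnionRel 𝕏) (preimage-spec s) (preimage-spec s') (proj₂ cond _ _ (inRel r)))

module Reassembly {I : Set} {𝕏 : I → Structure} (g : I → I)
    (A : (i : I) → Carrier (𝕏 (g i)) → Bool) (partition : IsFiberPartition 𝕏 g A)
    (iso : ∀ i → Sub (𝕏 (g i)) (A i) ≅ 𝕏 i) where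

  open Points (λ i → Carrier (𝕏 i))
  private module B (i : I) = Iso {Sub (𝕏 (g i)) (A i)} {𝕏 i} (iso i)

  reassemble : Carrier (⋃ 𝕏) → Carrier (⋃ 𝕏)
  reassemble (i , x) = g i , proj₁ (B.from i x)

  reassemble-injective : Injective _≡_ _≡_ reassemble
  reassemble-injective {i , x} {i' , x'} e
    with proj₂ partition (g i') _ i i' (,-injectiveˡ e) refl
           (subst (λ y → A i y ≡ true) (sym (transport-snd e)) (proj₂ (B.from i x)))
           (proj₂ (B.from i' x'))
  ... | refl = cong (i ,_) (B.from-injective i (Sub-≡ {𝕏 (g i)} {A i} (snd-injective e)))

  reassemble-surjective : Surjective _≡_ _≡_ reassemble
  reassemble-surjective (j , y) =
    let (i , p , a) = proj₁ partition j y
        s = (subst (λ k → Carrier (𝕏 k)) (sym p) y , a)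
    in (i , B.to i s) ,
       λ { refl → trans (cong (λ t → g i , proj₁ t) (B.from-to i s)) (transport-pair p y) }

  reassemble-hom : IsHom (⋃ 𝕏) (⋃ 𝕏) reassemble
  reassemble-hom (i , x) (.i , y) (inRel r) = inRel (B.from-preserves i r)

  reassemble-condensation : IsCondensation (⋃ 𝕏) (⋃ 𝕏) reassemble
  reassemble-condensation = (reassemble-injective , reassemble-surjective) , reassemble-hom

FibreDecomposition : {I : Set} → (I → Structure) → Set
FibreDecomposition {I} 𝕏 =
  Σ[ f ∈ (I → I) ] Surjective _≡_ _≡_ f × ¬ Injective _≡_ _≡_ f ×
  Σ[ A ∈ ((i : I) → Carrier (𝕏 (f i)) → Bool) ]
  IsFiberPartition 𝕏 f A × (∀ i → Sub (𝕏 (f i)) (A i) ≅ 𝕏 i)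

corollary2p6 : Classical → (I : Set) (𝕏 : I → Structure) →
    (∀ i → IsTournament (𝕏 i)) → (∀ i → Carrier (𝕏 i)) →
    (¬ Reversible (⋃ 𝕏)) ⇔
    (Σ[ f ∈ (I → I) ] Surjective _≡_ _≡_ f × ¬ Injective _≡_ _≡_ f ×
    Σ[ A ∈ ((i : I) → Carrier (𝕏 (f i)) → Bool) ]
    IsFiberPartition 𝕏 f A × (∀ i → Sub (𝕏 (f i)) (A i) ≅ 𝕏 i))
corollary2p6 cl I 𝕏 T x₀ = mk⇔ forward backward
  where
  -- A condensation that is not an automorphism has a non-injective
  -- component map, and its fibre decomposition is the required data.
  forward : ¬ Reversible (⋃ 𝕏) → FibreDecomposition 𝕏
  forward nonrev =
    let (F , cond , notAuto) = nonReversible⇒witness cl (⋃ 𝕏) nonrev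
        open SelfCondensation cl T x₀ F cond
    in g , g-surjective , (λ g-inj → notAuto (injective⇒automorphism g-inj)) ,
       image , image-partition , image≅component

  -- The reassembled condensation has component map g; were it an
  -- automorphism, g would be injective.
  backward : FibreDecomposition 𝕏 → ¬ Reversible (⋃ 𝕏)
  backward (g , _ , g-noninj , A , partition , iso) reversible =
    let open Reassembly {𝕏 = 𝕏} g A partition iso
        open SelfCondensation cl T x₀ reassemble reassemble-condensation
    in g-noninj (automorphism⇒injective (reversible reassemble reassemble-condensation))
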